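{- Let $\mathcal{P}$ and $\mathcal{Q}$ be finite chiral or directly regular $n$-polytopes, not both directly regular. Suppose that $|X(\mathcal{P})|$ does not divide $|\Gamma^+(\mathcal{Q})|$ or that $|X(\mathcal{Q})|$ does not divide $|\Gamma^+(\mathcal{P})|$. Then $\mathcal{P}\diamond\mathcal{Q}$ is chiral.
   Context: All polytopes are abstract polytopes. A regular polytope is directly regular if its rotation group $\Gamma^+(\mathcal{P})$, generated by $\sigma_i=\rho_{i-1}\rho_i$ ($\rho_0,\dots,\rho_{n-1}$ the standard generating involutions relative to a base flag), has index $2$ in the automorphism group. A polytope is chiral if its automorphism group has two orbits on flags, adjacent flags lying in distinct orbits; then $\Gamma^+(\mathcal{P})$ is the full automorphism group, generated by standard rotations $\sigma_1,\dots,\sigma_{n-1}$. Let $W^+=\langle \sigma_1,\dots,\sigma_{n-1}\mid (\sigma_i\cdots\sigma_j)^2=1,\ 1\le i<j\le n-1\rangle$; each such $\Gamma^+(\mathcal{P})$ equals $W^+/M$ for a normal subgroup $M$, generators corresponding. Let $w\mapsto\overline{w}$ be the automorphism of $W^+$ with $\sigma_1\mapsto\sigma_1^{ -1}$, $\sigma_2\mapsto\sigma_1^2\sigma_2$, $\sigma_j\mapsto\sigma_j$ ($j\ge3$), and $\overline{M}=\{\overline w: w\in M\}$. Mix: if $\Gamma^+(\mathcal{P})=W^+/M$ and $\Gamma^+(\mathcal{Q})=W^+/K$, the mix $\mathcal{P}\diamond\mathcal{Q}$ is the (flag-connected pre-)polytope whose rotation group is the subgroup of $\Gamma^+(\mathcal{P})\times\Gamma^+(\mathcal{Q})$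 generated by $(\sigma_i,\sigma_i')$, which is isomorphic to $W^+/N$ with $N=M\cap K$; it is directly regular if $\overline N=N$ and chiral otherwise (polytopality is not asserted). Chirality group: for $\Gamma^+(\mathcal{P})=W^+/M$, $X(\mathcal{P})$ is the kernel of the natural epimorphism $W^+/M\to W^+/(M\overline{M})$, i.e. $X(\mathcal{P})=M\overline{M}/M$ (isomorphic to $M/(M\cap\overline M)$, the kernel of the natural map from $W^+/(M\cap\overline M)$, the rotation group of $\mathcal{P}\diamond\overline{\mathcal{P}}$, onto $W^+/\overline M$). -}

module Defs where

open import Level using (Level; _⊔_)
open import Data.Nat using (ℕ; _≤_; _<_; _∸_)
open import Data.Nat.Properties using (_≤?_)
open import Data.Fin using (Fin; zero; suc; toℕ)
open import Data.List using (List; []; _∷_; _++_; reverse; map; filter; allFin)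
open import Data.Bool using (Bool; true; false; not)
open import Data.Product using (Σ; ∃; _×_; _,_; proj₁)
open import Relation.Nullary using (¬_)
open import Relation.Nullary.Decidable using (_×-dec_)
open import Relation.Binary using (Setoid)
open import Relation.Binary.PropositionalEquality as ≡ using (_≡_)
open import Algebra.Bundles using (Group)
open import Function.Bundles using (Bijection)

-- Letters of the free group on the rotations σ₁,…,σₘ (m = n-1):
-- (k , false) is σ_{k+1}, (k , true) is σ_{k+1}⁻¹.
Letter : ℕ → Set
Letter m = Fin m × Bool

Word : ℕ → Set
Word m = List (Letter m)

invW : ∀ {m} → Word m → Word m
invW w = reverse (map (λ { (k , b) → (k , not b) }) w)

-- the automorphism w ↦ w̄ : σ₁ ↦ σ₁⁻¹, σ₂ ↦ σ₁²σ₂, σⱼ ↦ σⱼ (j ≥ 3)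
barGen : ∀ {m} → Fin m → Word m
barGen zero = (zero , true) ∷ []
barGen (suc zero) = (zero , false) ∷ (zero , false) ∷ (suc zero , false) ∷ []
barGen (suc (suc k)) = (suc (suc k) , false) ∷ []

barW : ∀ {m} → Word m → Word m
barW [] = []
barW ((k , false) ∷ w) = barGen k ++ barW w
barW ((k , true) ∷ w) = invW (barGen k) ++ barW w

-- the word σ_{i+1} σ_{i+2} ⋯ σ_{j+1}
segment : ∀ {m} → Fin m → Fin m → Word m
segment {m} i j =
  map (λ k → (k , false))
      (filter (λ k → (toℕ i ≤? toℕ k) ×-dec (toℕ k ≤? toℕ j)) (allFin m))

module _ {c ℓ : Level} (G : Group c ℓ) where
  open Group G

  eval : ∀ {m} → (Fin m → Carrier) → Word m → Carrier
  eval g [] = ε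
  eval g ((k , false) ∷ w) = g k ∙ eval g w
  eval g ((k , true) ∷ w) = (g k ⁻¹) ∙ eval g w

-- A rotation group Γ⁺ = W⁺/M of rank n (m = n - 1 rotations):
-- a group generated by σ₁,…,σₘ satisfying (σᵢ⋯σⱼ)² = 1 for i < j.
record RotGroup (m : ℕ) (c ℓ : Level) : Set (Level.suc (c ⊔ ℓ)) where
  field
    grp       : Group c ℓ
  open Group grp public
  field
    σ         : Fin m → Carrier
    relations : ∀ (i j : Fin m) → toℕ i < toℕ j →
                eval grp σ (segment i j ++ segment i j) ≈ ε
    generated : ∀ (x : Carrier) → ∃ λ (w : Word m) → eval grp σ w ≈ x

  -- the normal subgroup M of W⁺ (as its preimage in the free group)
  inM : Word m → Set ℓ
  inM w = eval grp σ w ≈ ε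

  DirectlyRegular : Set ℓ
  DirectlyRegular = ∀ (w : Word m) → (inM w → inM (barW w)) × (inM (barW w) → inM w)

  -- the chirality group X = M M̄ / M, i.e. the image of M̄ in Γ⁺ = W⁺/M
  chiralityGroup : Setoid (c ⊔ ℓ) ℓ
  chiralityGroup = record
    { Carrier = Σ Carrier (λ x → ∃ λ (w : Word m) → inM w × (eval grp σ (barW w) ≈ x))
    ; _≈_ = λ x y → proj₁ x ≈ proj₁ y
    ; isEquivalence = record { refl = refl ; sym = sym ; trans = trans }
    }

HasSize : ∀ {a b} → Setoid a b → ℕ → Set (a ⊔ b)
HasSize S k = Bijection (≡.setoid (Fin k)) S

module _ {m : ℕ} {c₁ ℓ₁ c₂ ℓ₂ : Level} (P : RotGroup m c₁ ℓ₁) (Q : RotGroup m c₂ ℓ₂) where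
  private
    module P = RotGroup P
    module Q = RotGroup Q

  -- N = M ∩ K, the kernel for the mix P ◇ Q
  inMix : Word m → Set (ℓ₁ ⊔ ℓ₂)
  inMix w = P.inM w × Q.inM w

  MixDirectlyRegular : Set (ℓ₁ ⊔ ℓ₂)
  MixDirectlyRegular = ∀ (w : Word m) → (inMix w → inMix (barW w)) × (inMix (barW w) → inMix w)

  MixChiral : Set (ℓ₁ ⊔ ℓ₂)
  MixChiral = ¬ MixDirectlyRegular

module Submission where

-- Suppose, for a contradiction, that the mix is directly regular: N̄ = N for
-- N = M ∩ K, where Γ⁺(P) = W⁺/M and Γ⁺(Q) = W⁺/K.  Let MImage ≤ Γ⁺(Q) be
-- the image of M.  For w ∈ M the element w̄M ∈ X(P) depends only on the image
-- of w in Γ⁺(Q): if w, w' ∈ M have the same image, then w⁻¹w' ∈ N = N̄, so w̄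
-- and w̄' agree modulo M.  This gives a surjective homomorphism
-- MImage → X(P) whose fibres are the cosets of its kernel BarKernel, so
-- |MImage| = |X(P)| · |BarKernel|; by Lagrange |MImage| divides |Γ⁺(Q)|,
-- hence |X(P)| divides |Γ⁺(Q)|.

open import Defs
open import Level using (Level; _⊔_)
open import Data.Nat using (ℕ; zero; suc; _*_; _∸_)
open import Data.Nat.Divisibility using (_∣_; divides; m∣m*n; ∣-trans)
open import Data.Fin using (Fin; zero; suc; combine; remQuot; _≟_)
open import Data.Fin.Properties
  using (cantor-schröder-bernstein; combine-injective; combine-remQuot; suc-injective)
open import Data.Bool using (true; false; not)
open import Data.List using ([]; _∷_; _++_; map)
open import Data.List.Properties using (++-assoc; unfold-reverse; ++-identityʳ)
open import Data.Maybe using (Maybe; just; nothing)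
open import Data.Maybe.Properties using (just-injective)
open import Data.Product using (Σ; ∃; _×_; _,_; proj₁; proj₂; swap)
open import Data.Sum using (_⊎_; inj₁; inj₂)
open import Data.Empty using (⊥-elim)
open import Relation.Nullary using (¬_; Dec; yes; no)
open import Relation.Nullary.Decidable using (map′)
open import Relation.Unary using (Pred; Decidable)
open import Relation.Binary using (Setoid)
import Relation.Binary.Construct.On as On
open import Relation.Binary.PropositionalEquality as ≡ using (_≡_; refl)
open import Function.Bundles using (Bijection)
open import Algebra.Bundles using (Group)
import Algebra.Properties.Group as GroupProperties

private
  variable
    a b c ℓ ℓa ℓb ℓc p p′ : Level

Sub : (S : Setoid a ℓ) → Pred (Setoid.Carrier S) p → Setoid (a ⊔ p) ℓ
Sub S P = On.setoid S (proj₁ {B = P})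

module Enumeration {S : Setoid a ℓ} {k : ℕ} (E : HasSize S k) where
  open Setoid S
  open Bijection E public using (to; injective)

  from : Carrier → Fin k
  from = Bijection.to⁻ E

  to-from : ∀ x → to (from x) ≈ x
  to-from x = proj₂ (Bijection.strictlySurjective E x)

  from-to : ∀ i → from (to i) ≡ i
  from-to i = injective (to-from (to i))

  from-cong : ∀ {x y} → x ≈ y → from x ≡ from y
  from-cong {x} {y} x≈y = injective (trans (to-from x) (trans x≈y (sym (to-from y))))

mkHasSize : {S : Setoid a ℓ} {k : ℕ} (f : Fin k → Setoid.Carrier S) →
  (∀ {i j} → Setoid._≈_ S (f i) (f j) → i ≡ j) →
  (∀ x → ∃ λ i → Setoid._≈_ S (f i) x) → HasSize S k
mkHasSize {S = S} f f-injective f-onto = record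
  { to = f
  ; cong = λ { refl → Setoid.refl S }
  ; bijective = f-injective
              , λ x → proj₁ (f-onto x) , λ { refl → proj₂ (f-onto x) }
  }

record Listing (n : ℕ) (P : Pred (Fin n) p) : Set p where
  field
    size         : ℕ
    elem         : Fin size → Fin n
    elem-sat     : ∀ j → P (elem j)
    elem-inj     : ∀ {j j'} → elem j ≡ elem j' → j ≡ j'
    elem-onto    : ∀ i → P i → ∃ λ j → elem j ≡ i

listing : ∀ n (P : Pred (Fin n) p) → Decidable P → Listing n P
listing zero P P? = record
  { size = 0 ; elem = λ () ; elem-sat = λ () ; elem-inj = λ { {()} } ; elem-onto = λ () }
listing (suc n) P P? with listing n (λ i → P (suc i)) (λ i → P? (suc i)) | P? zero
... | L | yes P0 = record
  { size = suc L.size ; elem = elem ; elem-sat = sat ; elem-inj = inj ; elem-onto = onto }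
  where
  module L = Listing L
  elem : Fin (suc L.size) → Fin (suc n)
  elem zero = zero
  elem (suc j) = suc (L.elem j)
  sat : ∀ j → P (elem j)
  sat zero = P0
  sat (suc j) = L.elem-sat j
  inj : ∀ {j j'} → elem j ≡ elem j' → j ≡ j'
  inj {zero} {zero} _ = refl
  inj {suc j} {suc j'} eq = ≡.cong suc (L.elem-inj (suc-injective eq))
  onto : ∀ i → P i → ∃ λ j → elem j ≡ i
  onto zero _ = zero , refl
  onto (suc i) Pi with L.elem-onto i Pi
  ... | j , eq = suc j , ≡.cong suc eq
... | L | no ¬P0 = record
  { size = L.size ; elem = λ j → suc (L.elem j) ; elem-sat = L.elem-sat
  ; elem-inj = λ eq → L.elem-inj (suc-injective eq) ; elem-onto = onto }
  where
  module L = Listing L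
  onto : ∀ i → P i → ∃ λ j → suc (L.elem j) ≡ i
  onto zero P0 = ⊥-elim (¬P0 P0)
  onto (suc i) Pi with L.elem-onto i Pi
  ... | j , eq = j , ≡.cong suc eq

subset-size : {S : Setoid a ℓ} {n : ℕ} → HasSize S n → (P : Pred (Setoid.Carrier S) p) →
  (∀ {x y} → Setoid._≈_ S x y → P x → P y) → Decidable P → ∃ λ k → HasSize (Sub S P) k
subset-size {S = S} {n} E P resp P? =
  L.size , mkHasSize enum (λ eq → L.elem-inj (injective eq)) onto
  where
  open Setoid S
  open Enumeration E
  L : Listing n (λ i → P (to i))
  L = listing n (λ i → P (to i)) (λ i → P? (to i))
  module L = Listing L
  enum : Fin L.size → Σ Carrier P
  enum j = to (L.elem j) , L.elem-sat j
  onto : ∀ (y : Σ Carrier P) → ∃ λ j → to (L.elem j) ≈ proj₁ y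
  onto (x , Px) with L.elem-onto (from x) (resp (sym (to-from x)) Px)
  ... | j , eq = j , trans (reflexive (≡.cong to eq)) (to-from x)

-- Constructively we cannot decide an arbitrary predicate, but over a finite
-- domain its decidability is not refutable; this suffices to refute a claim.
¬¬-decidable-Fin : ∀ n (P : Pred (Fin n) p) → ¬ ¬ Decidable P
¬¬-decidable-Fin zero P ¬dec = ¬dec (λ ())
¬¬-decidable-Fin (suc n) P ¬dec = ¬¬-decidable-Fin n (λ i → P (suc i)) λ dec-suc →
  ¬dec (cons (no λ P0 → ¬dec (cons (yes P0) dec-suc)) dec-suc)
  where
  cons : Dec (P zero) → Decidable (λ i → P (suc i)) → Decidable P
  cons dec0 _ zero = dec0
  cons _ dec-suc (suc i) = dec-suc i

¬¬-decidable : {S : Setoid a ℓ} {n : ℕ} → HasSize S n → (P : Pred (Setoid.Carrier S) p) →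
  (∀ {x y} → Setoid._≈_ S x y → P x → P y) → ¬ ¬ Decidable P
¬¬-decidable {S = S} {n} E P resp ¬dec = ¬¬-decidable-Fin n (λ i → P (to i)) λ dec →
  ¬dec λ x → map′ (resp (to-from x)) (resp (Setoid.sym S (to-from x))) (dec (from x))
  where open Enumeration E

first : ∀ {n} (P : Pred (Fin n) p) → Decidable P → Maybe (Fin n)
first {n = zero} P P? = nothing
first {n = suc n} P P? with P? zero
... | yes _ = just zero
... | no _ with first (λ i → P (suc i)) (λ i → P? (suc i))
...   | just j = just (suc j)
...   | nothing = nothing

first-found : ∀ {n} (P : Pred (Fin n) p) (P? : Decidable P) (i : Fin n) → P i →
  ∃ λ j → first P P? ≡ just j × P j
first-found {n = suc n} P P? i Pi with P? zero
... | yes P0 = zero , refl , P0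
first-found {n = suc n} P P? zero P0 | no ¬P0 = ⊥-elim (¬P0 P0)
first-found {n = suc n} P P? (suc i) Pi | no _
  with first (λ i → P (suc i)) (λ i → P? (suc i))
     | first-found (λ i → P (suc i)) (λ i → P? (suc i)) i Pi
... | just j | .j , refl , Pj = suc j , refl , Pj

first-ext : ∀ {n} (P : Pred (Fin n) p) (P′ : Pred (Fin n) p′) P? P′? →
  (∀ i → P i → P′ i) → (∀ i → P′ i → P i) → first P P? ≡ first P′ P′?
first-ext {n = zero} P P′ P? P′? to fro = refl
first-ext {n = suc n} P P′ P? P′? to fro with P? zero | P′? zero
... | yes _ | yes _ = refl
... | yes P0 | no ¬P′0 = ⊥-elim (¬P′0 (to zero P0))
... | no ¬P0 | yes P′0 = ⊥-elim (¬P0 (fro zero P′0))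
... | no _ | no _
  rewrite first-ext (λ i → P (suc i)) (λ i → P′ (suc i)) (λ i → P? (suc i)) (λ i → P′? (suc i))
                    (λ i → to (suc i)) (λ i → fro (suc i)) = refl

record UniformFibres (A : Setoid a ℓa) (B : Setoid b ℓb) (C : Setoid c ℓc)
    (f : Setoid.Carrier A → Setoid.Carrier B) : Set (a ⊔ ℓa ⊔ b ⊔ ℓb ⊔ c ⊔ ℓc) where
  private
    module A = Setoid A
    module B = Setoid B
    module C = Setoid C
  field
    fibre           : B.Carrier → C.Carrier → A.Carrier
    fibre-cong      : ∀ y {z z'} → z C.≈ z' → fibre y z A.≈ fibre y z'
    fibre-injective : ∀ y {z z'} → fibre y z A.≈ fibre y z' → z C.≈ z'
    fibre-over      : ∀ y z → f (fibre y z) B.≈ y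
    fibre-onto      : ∀ y x → f x B.≈ y → ∃ λ z → fibre y z A.≈ x

-- Counting with uniform fibres: |A| = |B| · |C|.  The maps
-- (i , j) ↦ fibre (bᵢ) (cⱼ) and x ↦ (f x , its parameter in the fibre)
-- are injections Fin (|B|·|C|) ⇄ Fin |A|.
fibration-count : {A : Setoid a ℓa} {B : Setoid b ℓb} {C : Setoid c ℓc}
  {na nb nc : ℕ} → HasSize A na → HasSize B nb → HasSize C nc →
  (f : Setoid.Carrier A → Setoid.Carrier B) →
  (∀ {x y} → Setoid._≈_ A x y → Setoid._≈_ B (f x) (f y)) →
  UniformFibres A B C f → na ≡ nb * nc
fibration-count {A = A} {B} {C} {na} {nb} {nc} EA EB EC f f-cong F =
  cantor-schröder-bernstein {f = split} {g = glue} split-injective glue-injective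
  where
  module A = Setoid A
  module B = Setoid B
  module C = Setoid C
  module EA = Enumeration EA
  module EB = Enumeration EB
  module EC = Enumeration EC
  open UniformFibres F

  glue : Fin (nb * nc) → Fin na
  glue k = EA.from (fibre (EB.to (proj₁ (pair k))) (EC.to (proj₂ (pair k))))
    where
    pair : Fin (nb * nc) → Fin nb × Fin nc
    pair = remQuot {nb} nc

  glue-injective : ∀ {k k'} → glue k ≡ glue k' → k ≡ k'
  glue-injective {k} {k'} eq = ≡.trans (≡.sym (combine-remQuot {nb} nc k))
    (≡.trans (≡.cong₂ combine i≡i' j≡j') (combine-remQuot {nb} nc k'))
    where
    i i' : Fin nb
    i = proj₁ (remQuot {nb} nc k) ; i' = proj₁ (remQuot {nb} nc k')
    j j' : Fin nc
    j = proj₂ (remQuot {nb} nc k) ; j' = proj₂ (remQuot {nb} nc k')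
    same : fibre (EB.to i) (EC.to j) A.≈ fibre (EB.to i') (EC.to j')
    same = A.trans (A.sym (EA.to-from _)) (A.trans (A.reflexive (≡.cong EA.to eq)) (EA.to-from _))
    i≡i' : i ≡ i'
    i≡i' = EB.injective (B.trans (B.sym (fibre-over _ _)) (B.trans (f-cong same) (fibre-over _ _)))
    j≡j' : j ≡ j'
    j≡j' = EC.injective (fibre-injective (EB.to i)
      (A.trans same (A.reflexive (≡.cong (λ t → fibre (EB.to t) (EC.to j')) (≡.sym i≡i')))))

  base : Fin na → Fin nb
  base k = EB.from (f (EA.to k))

  parameter : ∀ k → ∃ λ z → fibre (EB.to (base k)) z A.≈ EA.to k
  parameter k = fibre-onto _ (EA.to k) (B.sym (EB.to-from _))

  coordinate : Fin na → C.Carrier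
  coordinate k = proj₁ (parameter k)

  split : Fin na → Fin (nb * nc)
  split k = combine (base k) (EC.from (coordinate k))

  split-injective : ∀ {k k'} → split k ≡ split k' → k ≡ k'
  split-injective {k} {k'} eq = EA.injective (begin
    EA.to k                                  ≈⟨ A.sym (proj₂ (parameter k)) ⟩
    fibre (EB.to (base k)) (coordinate k)    ≈⟨ fibre-cong _ same-coordinate ⟩
    fibre (EB.to (base k)) (coordinate k')   ≡⟨ ≡.cong (λ t → fibre (EB.to t) z') same-base ⟩
    fibre (EB.to (base k')) (coordinate k')  ≈⟨ proj₂ (parameter k') ⟩
    EA.to k'                                 ∎)
    where
    open import Relation.Binary.Reasoning.Setoid A
    z' : C.Carrier
    z' = coordinate k'
    same-indices : base k ≡ base k' × EC.from (coordinate k) ≡ EC.from (coordinate k')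
    same-indices = combine-injective (base k) _ (base k') _ eq
    same-base : base k ≡ base k'
    same-base = proj₁ same-indices
    same-coordinate : coordinate k C.≈ coordinate k'
    same-coordinate = C.trans (C.sym (EC.to-from (coordinate k)))
      (C.trans (C.reflexive (≡.cong EC.to (proj₂ same-indices))) (EC.to-from (coordinate k')))

record IsSubgroup (G : Group c ℓ) (H : Pred (Group.Carrier G) p) : Set (c ⊔ ℓ ⊔ p) where
  open Group G
  field
    resp : ∀ {x y} → x ≈ y → H x → H y
    ε∈   : H ε
    ∙∈   : ∀ {x y} → H x → H y → H (x ∙ y)
    ⁻¹∈  : ∀ {x} → H x → H (x ⁻¹)

-- The first
-- element (in the enumeration of G) of each coset is its representative;
-- G has uniform fibres over the set of representatives, each a copy of H.
module Cosets (G : Group c ℓ) {H : Pred (Group.Carrier G) p} (H-sub : IsSubgroup G H)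
    (H? : Decidable H) {n : ℕ} (EG : HasSize (Group.setoid G) n) where
  open Group G
  open GroupProperties G using (⁻¹-anti-homo-\\; \\-leftDividesˡ; \\-leftDividesʳ; ∙-cancelˡ)
  open IsSubgroup H-sub
  open Enumeration EG

  SameCoset : Carrier → Carrier → Set p
  SameCoset x y = H (x \\ y)

  coset-refl : ∀ {x y} → x ≈ y → SameCoset x y
  coset-refl {x} x≈y = resp (trans (sym (inverseˡ x)) (∙-congˡ x≈y)) ε∈

  coset-sym : ∀ {x y} → SameCoset x y → SameCoset y x
  coset-sym {x} {y} h = resp (⁻¹-anti-homo-\\ x y) (⁻¹∈ h)

  coset-trans : ∀ {x y z} → SameCoset x y → SameCoset y z → SameCoset x z
  coset-trans {x} {y} {z} h h' =
    resp (trans (assoc (x ⁻¹) y (y \\ z)) (∙-congˡ (\\-leftDividesˡ y z))) (∙∈ h h')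

  found : ∀ x → ∃ λ j → first (λ j → SameCoset x (to j)) (λ j → H? (x \\ to j)) ≡ just j
                        × SameCoset x (to j)
  found x = first-found _ (λ j → H? (x \\ to j)) (from x) (coset-refl (sym (to-from x)))

  rep : Carrier → Fin n
  rep x = proj₁ (found x)

  rep-coset : ∀ x → SameCoset x (to (rep x))
  rep-coset x = proj₂ (proj₂ (found x))

  rep-cong : ∀ {x y} → SameCoset x y → rep x ≡ rep y
  rep-cong {x} {y} h = just-injective (≡.trans (≡.sym (proj₁ (proj₂ (found x))))
    (≡.trans (first-ext _ _ (λ j → H? (x \\ to j)) (λ j → H? (y \\ to j))
                (λ j → coset-trans (coset-sym h)) (λ j → coset-trans h))
             (proj₁ (proj₂ (found y)))))

  IsRep : Carrier → Set
  IsRep x = rep x ≡ from x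

  IsRep-resp : ∀ {x y} → x ≈ y → IsRep x → IsRep y
  IsRep-resp x≈y r = ≡.trans (≡.sym (rep-cong (coset-refl x≈y))) (≡.trans r (from-cong x≈y))

  IsRep? : Decidable IsRep
  IsRep? x = rep x ≟ from x

  representative : Carrier → Σ Carrier IsRep
  representative x = to (rep x) , ≡.trans (≡.sym (rep-cong (rep-coset x))) (≡.sym (from-to (rep x)))

  representative-cong : ∀ {x y} → x ≈ y → to (rep x) ≈ to (rep y)
  representative-cong x≈y = reflexive (≡.cong to (rep-cong (coset-refl x≈y)))

  cosets : UniformFibres setoid (Sub setoid IsRep) (Sub setoid H) representative
  cosets = record
    { fibre           = λ b h → proj₁ b ∙ proj₁ h
    ; fibre-cong      = λ b → ∙-congˡ
    ; fibre-injective = λ b → ∙-cancelˡ (proj₁ b) _ _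
    ; fibre-over      = over
    ; fibre-onto      = onto
    }
    where
    over : ∀ (b : Σ Carrier IsRep) (h : Σ Carrier H) → to (rep (proj₁ b ∙ proj₁ h)) ≈ proj₁ b
    over (b , b-rep) (h , h∈H) = trans (reflexive (≡.cong to rep-bh≡from-b)) (to-from b)
      where
      rep-bh≡from-b : rep (b ∙ h) ≡ from b
      rep-bh≡from-b = ≡.trans (≡.sym (rep-cong (resp (sym (\\-leftDividesʳ b h)) h∈H))) b-rep
    onto : ∀ (b : Σ Carrier IsRep) x → to (rep x) ≈ proj₁ b →
      ∃ λ (h : Σ Carrier H) → proj₁ b ∙ proj₁ h ≈ x
    onto (b , _) x rep≈b =
      (b \\ x , coset-sym (resp (∙-congˡ rep≈b) (rep-coset x))) , \\-leftDividesˡ b x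

lagrange : (G : Group c ℓ) {H : Pred (Group.Carrier G) p} → IsSubgroup G H → Decidable H →
  {n k : ℕ} → HasSize (Group.setoid G) n → HasSize (Sub (Group.setoid G) H) k → k ∣ n
lagrange G H-sub H? {n} {k} EG EH = divides r n≡r*k
  where
  open Cosets G H-sub H? EG
  representatives : ∃ λ r → HasSize (Sub (Group.setoid G) IsRep) r
  representatives = subset-size EG IsRep IsRep-resp IsRep?
  r : ℕ
  r = proj₁ representatives
  n≡r*k : n ≡ r * k
  n≡r*k = fibration-count EG (proj₂ representatives) EH representative representative-cong cosets

module LeftDivision (G : Group c ℓ) where
  open Group G
  open GroupProperties G using (⁻¹-injective; inverseˡ-unique)

  \\≈ε⇒≈ : ∀ {x y} → x \\ y ≈ ε → x ≈ y
  \\≈ε⇒≈ {x} {y} eq = ⁻¹-injective (inverseˡ-unique (x ⁻¹) y eq)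

  ≈⇒\\≈ε : ∀ {x y} → x ≈ y → x \\ y ≈ ε
  ≈⇒\\≈ε {x} x≈y = trans (∙-congˡ (sym x≈y)) (inverseˡ x)

invW-∷ : ∀ {m} (k : Fin m) b u → invW ((k , b) ∷ u) ≡ invW u ++ ((k , not b) ∷ [])
invW-∷ k b u = unfold-reverse (k , not b) (map (λ { (k , b) → (k , not b) }) u)

barW-++ : ∀ {m} (u v : Word m) → barW (u ++ v) ≡ barW u ++ barW v
barW-++ [] v = refl
barW-++ ((k , false) ∷ u) v rewrite barW-++ u v = ≡.sym (++-assoc (barGen k) (barW u) (barW v))
barW-++ ((k , true) ∷ u) v rewrite barW-++ u v = ≡.sym (++-assoc (invW (barGen k)) (barW u) (barW v))

module WordHomomorphism (G : Group c ℓ) {m : ℕ} (F : Word m → Group.Carrier G)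
    (F-++ : ∀ u v → Group._≈_ G (F (u ++ v)) (Group._∙_ G (F u) (F v)))
    (F-letter : ∀ k → Group._≈_ G (F ((k , true) ∷ [])) (Group._⁻¹ G (F ((k , false) ∷ []))))
    where
  open Group G
  open GroupProperties G using (ε⁻¹≈ε; ⁻¹-involutive; ⁻¹-anti-homo-∙; ∙-cancelˡ)
  open import Relation.Binary.Reasoning.Setoid setoid

  F-[] : F [] ≈ ε
  F-[] = ∙-cancelˡ (F []) (F []) ε (trans (sym (F-++ [] [])) (sym (identityʳ (F []))))

  F-flip : ∀ k b → F ((k , not b) ∷ []) ≈ F ((k , b) ∷ []) ⁻¹
  F-flip k false = F-letter k
  F-flip k true = trans (sym (⁻¹-involutive _)) (⁻¹-cong (sym (F-letter k)))

  F-invW : ∀ u → F (invW u) ≈ F u ⁻¹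
  F-invW [] = trans F-[] (trans (sym ε⁻¹≈ε) (⁻¹-cong (sym F-[])))
  F-invW ((k , b) ∷ u) = begin
    F (invW ((k , b) ∷ u))                ≡⟨ ≡.cong F (invW-∷ k b u) ⟩
    F (invW u ++ ((k , not b) ∷ []))      ≈⟨ F-++ (invW u) _ ⟩
    F (invW u) ∙ F ((k , not b) ∷ [])     ≈⟨ ∙-cong (F-invW u) (F-flip k b) ⟩
    F u ⁻¹ ∙ F ((k , b) ∷ []) ⁻¹          ≈⟨ ⁻¹-anti-homo-∙ _ _ ⟨
    (F ((k , b) ∷ []) ∙ F u) ⁻¹           ≈⟨ ⁻¹-cong (F-++ ((k , b) ∷ []) u) ⟨
    F ((k , b) ∷ u) ⁻¹                    ∎

module Evaluation (G : Group c ℓ) {m : ℕ} (g : Fin m → Group.Carrier G) where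
  open Group G

  ev : Word m → Carrier
  ev = eval G g

  bar : Word m → Carrier
  bar w = ev (barW w)

  ev-++ : ∀ u v → ev (u ++ v) ≈ ev u ∙ ev v
  ev-++ [] v = sym (identityˡ _)
  ev-++ ((k , false) ∷ u) v = trans (∙-congˡ (ev-++ u v)) (sym (assoc _ _ _))
  ev-++ ((k , true) ∷ u) v = trans (∙-congˡ (ev-++ u v)) (sym (assoc _ _ _))

  ev-invW : ∀ u → ev (invW u) ≈ ev u ⁻¹
  ev-invW = WordHomomorphism.F-invW G ev ev-++ λ k →
    trans (identityʳ _) (⁻¹-cong (sym (identityʳ (g k))))

  bar-++ : ∀ u v → bar (u ++ v) ≈ bar u ∙ bar v
  bar-++ u v = trans (reflexive (≡.cong ev (barW-++ u v))) (ev-++ (barW u) (barW v))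

  bar-invW : ∀ u → bar (invW u) ≈ bar u ⁻¹
  bar-invW = WordHomomorphism.F-invW G bar bar-++ λ k → begin
    ev (invW (barGen k) ++ [])   ≡⟨ ≡.cong ev (++-identityʳ (invW (barGen k))) ⟩
    ev (invW (barGen k))         ≈⟨ ev-invW (barGen k) ⟩
    ev (barGen k) ⁻¹             ≡⟨ ≡.cong (λ w → ev w ⁻¹) (++-identityʳ (barGen k)) ⟨
    ev (barGen k ++ []) ⁻¹       ∎
    where open import Relation.Binary.Reasoning.Setoid setoid

module DirectlyRegularMix {m : ℕ} {c₁ ℓ₁ c₂ ℓ₂ : Level}
    (P : RotGroup m c₁ ℓ₁) (Q : RotGroup m c₂ ℓ₂) (regular : MixDirectlyRegular P Q) where
  private
    module P = RotGroup P
    module Q = RotGroup Q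
    module WP = Evaluation P.grp P.σ
    module WQ = Evaluation Q.grp Q.σ
    module DP = LeftDivision P.grp
    module DQ = LeftDivision Q.grp
  open GroupProperties P.grp using (ε⁻¹≈ε)
  open GroupProperties Q.grp using (\\-leftDividesˡ; ∙-cancelˡ)

  M-++ : ∀ u v → P.inM u → P.inM v → P.inM (u ++ v)
  M-++ u v u∈M v∈M = P.trans (WP.ev-++ u v) (P.trans (P.∙-cong u∈M v∈M) (P.identityˡ P.ε))

  M-invW : ∀ u → P.inM u → P.inM (invW u)
  M-invW u u∈M = P.trans (WP.ev-invW u) (P.trans (P.⁻¹-cong u∈M) ε⁻¹≈ε)

  -- For w ∈ M, the element w̄M of X(P) only depends on the image of w in
  -- Γ⁺(Q): if also w' ∈ M has the same image, then u = w⁻¹w' ∈ M ∩ K = N,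
  -- hence ū ∈ N̄ = N ⊆ M, i.e. w̄ and w̄' agree in Γ⁺(P).
  bar-determined : ∀ w w' → P.inM w → P.inM w' → WQ.ev w Q.≈ WQ.ev w' → WP.bar w P.≈ WP.bar w'
  bar-determined w w' w∈M w'∈M same = DP.\\≈ε⇒≈ (P.trans
    (P.∙-congʳ (P.sym (WP.bar-invW w)))
    (P.trans (P.sym (WP.bar-++ (invW w) w')) ū∈M))
    where
    u : Word m
    u = invW w ++ w'
    u∈K : Q.inM u
    u∈K = Q.trans (WQ.ev-++ (invW w) w') (Q.trans (Q.∙-congʳ (WQ.ev-invW w)) (DQ.≈⇒\\≈ε same))
    ū∈M : P.inM (barW u)
    ū∈M = proj₁ (proj₁ (regular u) (M-++ (invW w) w' (M-invW w w∈M) w'∈M , u∈K))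

  MImage : Pred Q.Carrier (ℓ₁ ⊔ ℓ₂)
  MImage g = ∃ λ w → P.inM w × WQ.ev w Q.≈ g

  MImage-subgroup : IsSubgroup Q.grp MImage
  MImage-subgroup = record
    { resp = λ { eq (w , w∈M , w↦g) → w , w∈M , Q.trans w↦g eq }
    ; ε∈   = [] , P.refl , Q.refl
    ; ∙∈   = λ { (w , w∈M , w↦g) (w' , w'∈M , w'↦g') →
               w ++ w' , M-++ w w' w∈M w'∈M , Q.trans (WQ.ev-++ w w') (Q.∙-cong w↦g w'↦g') }
    ; ⁻¹∈  = λ { (w , w∈M , w↦g) → invW w , M-invW w w∈M , Q.trans (WQ.ev-invW w) (Q.⁻¹-cong w↦g) }
    }
  open IsSubgroup MImage-subgroup using () renaming (resp to MImage-resp)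

  BarKernel : Pred Q.Carrier (ℓ₁ ⊔ ℓ₂)
  BarKernel g = ∃ λ w → P.inM w × WP.bar w P.≈ P.ε × WQ.ev w Q.≈ g

  BarKernel-resp : ∀ {g g'} → g Q.≈ g' → BarKernel g → BarKernel g'
  BarKernel-resp eq (w , w∈M , w̄∈M , w↦g) = w , w∈M , w̄∈M , Q.trans w↦g eq

  toChirality : Σ Q.Carrier MImage → Setoid.Carrier P.chiralityGroup
  toChirality (_ , w , w∈M , _) = WP.bar w , w , w∈M , P.refl

  toChirality-cong : ∀ {a b} → proj₁ a Q.≈ proj₁ b →
    Setoid._≈_ P.chiralityGroup (toChirality a) (toChirality b)
  toChirality-cong {_ , w , w∈M , w↦g} {_ , w' , w'∈M , w'↦g'} eq =
    bar-determined w w' w∈M w'∈M (Q.trans w↦g (Q.trans eq (Q.sym w'↦g')))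

  toChirality-fibres : UniformFibres (Sub Q.setoid MImage) P.chiralityGroup (Sub Q.setoid BarKernel)
                                     toChirality
  toChirality-fibres = record
    { fibre           = fibre
    ; fibre-cong      = λ { (_ , v , _) → Q.∙-congˡ }
    ; fibre-injective = λ { (_ , v , _) → ∙-cancelˡ (WQ.ev v) _ _ }
    ; fibre-over      = over
    ; fibre-onto      = onto
    }
    where
    fibre : Setoid.Carrier P.chiralityGroup → Σ Q.Carrier BarKernel → Σ Q.Carrier MImage
    fibre (_ , v , v∈M , _) (k , u , u∈M , _ , u↦k) =
      WQ.ev v Q.∙ k , v ++ u , M-++ v u v∈M u∈M , Q.trans (WQ.ev-++ v u) (Q.∙-congˡ u↦k)
    over : ∀ y z → WP.bar (proj₁ (proj₂ (fibre y z))) P.≈ proj₁ y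
    over (y , v , _ , v̄↦y) (_ , u , _ , ū∈M , _) =
      P.trans (WP.bar-++ v u) (P.trans (P.∙-cong v̄↦y ū∈M) (P.identityʳ y))
    onto : ∀ y (a : Σ Q.Carrier MImage) → WP.bar (proj₁ (proj₂ a)) P.≈ proj₁ y →
      ∃ λ z → WQ.ev (proj₁ (proj₂ y)) Q.∙ proj₁ z Q.≈ proj₁ a
    onto (y , v , v∈M , v̄↦y) (g , w , w∈M , w↦g) w̄↦y =
      (WQ.ev v Q.\\ g , invW v ++ w , M-++ (invW v) w (M-invW v v∈M) w∈M ,
         P.trans (WP.bar-++ (invW v) w)
           (P.trans (P.∙-congʳ (WP.bar-invW v)) (DP.≈⇒\\≈ε (P.trans v̄↦y (P.sym w̄↦y)))) ,
         Q.trans (WQ.ev-++ (invW v) w) (Q.∙-cong (WQ.ev-invW v) w↦g)) ,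
      \\-leftDividesˡ (WQ.ev v) g

  -- Consequently |X(P)| divides |Γ⁺(Q)|.  Deciding membership in the image
  -- of M and in BarKernel is not refutable, which suffices for a negative goal.
  chirality-order-divides : ∀ {x q} → HasSize P.chiralityGroup x → HasSize Q.setoid q → ¬ ¬ (x ∣ q)
  chirality-order-divides {x} {q} EX EQ x∤q =
    ¬¬-decidable EQ MImage MImage-resp λ MImage? →
    ¬¬-decidable EQ BarKernel BarKernel-resp λ BarKernel? →
    let (h , EH) = subset-size EQ MImage MImage-resp MImage?
        (k , EK) = subset-size EQ BarKernel BarKernel-resp BarKernel?
        h≡x*k = fibration-count EH EX EK toChirality (λ {a} {b} → toChirality-cong {a} {b})
                                      toChirality-fibres
    in x∤q (∣-trans (≡.subst (x ∣_) (≡.sym h≡x*k) (m∣m*n k))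
                    (lagrange Q.grp MImage-subgroup MImage? EQ EH))

mix-swap : ∀ {m c₁ ℓ₁ c₂ ℓ₂} (P : RotGroup m c₁ ℓ₁) (Q : RotGroup m c₂ ℓ₂) →
  MixDirectlyRegular P Q → MixDirectlyRegular Q P
mix-swap P Q regular w = (λ n → swap (proj₁ (regular w) (swap n)))
                       , (λ n → swap (proj₂ (regular w) (swap n)))

theorem4p2 : ∀ {c₁ ℓ₁ c₂ ℓ₂ : Level} (n : ℕ)
    (P : RotGroup (n ∸ 1) c₁ ℓ₁) (Q : RotGroup (n ∸ 1) c₂ ℓ₂)
    (p q : ℕ) → HasSize (RotGroup.setoid P) p → HasSize (RotGroup.setoid Q) q →
    ¬ (RotGroup.DirectlyRegular P × RotGroup.DirectlyRegular Q) →
    (Σ ℕ (λ x → HasSize (RotGroup.chiralityGroup P) x × ¬ (x ∣ q))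
      ⊎ Σ ℕ (λ y → HasSize (RotGroup.chiralityGroup Q) y × ¬ (y ∣ p))) →
    MixChiral P Q
theorem4p2 n P Q p q _ EQ _ (inj₁ (x , EX , x∤q)) regular =
  DirectlyRegularMix.chirality-order-divides P Q regular EX EQ x∤q
theorem4p2 n P Q p q EP _ _ (inj₂ (y , EY , y∤p)) regular =
  DirectlyRegularMix.chirality-order-divides Q P (mix-swap P Q regular) EY EP y∤p
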